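{- Let $n\geq 1$ and let $K$ be a minimal simplicial complex generating $\mathsf{Mon}_n$. Then every maximal simplex of $K$ is an interval of $I_n$.
   Context: For finite sets $A,I$, a language is a subset $L\subseteq A^I$. For finite sets $B,J$ and a function $f:B^J\to A^I$, the input window $\mathcal{W}_f(i)\subseteq J$ of $i\in I$ is the smallest $W\subseteq J$ such that for all $x,y\in B^J$ agreeing on $W$, $f(x)_i=f(y)_i$. The communication complex $K_f$ is the simplicial complex on vertex set $I$ whose simplices are the sets $S\subseteq I$ with $\bigcap_{i\in S}\mathcal{W}_f(i)\neq\emptyset$. A simplicial complex $K$ on $I$ generates $L$ if there exist finite sets $B,J$ and $f:B^J\to A^I$ with $f(B^J)=L$ and $K_f\subseteq K$; $K$ is minimal generating $L$ if it generates $L$ and no complex properly contained in $K$ generates $L$. $\mathsf{Mon}_n\subseteq\{0,1\}^n$ is the set of binary strings $x_0\ldots x_{n-1}$ that are non-decreasing or non-increasing. Positions $I_n=\{0,\ldots,n-1\}$ are identified with $\mathbb{Z}/n\mathbb{Z}$. For $a,b\in\mathbb{Z}$, the interval $[\![a,b]\!]=\{c\bmod n: c\in\mathbb{Z},\ a\leq c\leq b'\}$ where $b'$ is the representative of $b$ modulo $n$ with $a\leq b'<a+n$. An interval is any set of the form $[\![a,b]\!]$. -}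

module Defs where

open import Data.Nat using (ℕ; _<_; _≤_; _%_; _+_; suc)
open import Data.Fin using (Fin; toℕ)
import Data.Fin as F
open import Data.Fin.Subset using (Subset; _∈_; _⊆_)
open import Data.Bool using (Bool; true; false)
import Data.Bool as B
open import Data.Product using (Σ; ∃; ∃-syntax; _×_; _,_)
open import Relation.Binary.PropositionalEquality using (_≡_; _≢_)
open import Relation.Nullary using (¬_)
open import Data.Sum using (_⊎_)

record Complex (n : ℕ) : Set where
  field
    simplex    : Subset n → Bool
    downClosed : ∀ {S T : Subset n} → T ⊆ S → simplex S ≡ true → simplex T ≡ true
open Complex public

_⊑_ : ∀ {n} → Complex n → Complex n → Set
K ⊑ K' = ∀ S → simplex K S ≡ true → simplex K' S ≡ true

_⊏_ : ∀ {n} → Complex n → Complex n → Set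
K ⊏ K' = (K ⊑ K') × (∃[ S ] (simplex K' S ≡ true × simplex K S ≡ false))

Language : Set → ℕ → Set₁
Language A n = (Fin n → A) → Set

-- Finite sets B, J are represented by Fin b, Fin j.
-- x, y agree on W
AgreeOn : ∀ {b j} → Subset j → (Fin j → Fin b) → (Fin j → Fin b) → Set
AgreeOn W x y = ∀ k → k ∈ W → x k ≡ y k

Determines : ∀ {A : Set} {n b j} → ((Fin j → Fin b) → (Fin n → A)) → Fin n → Subset j → Set
Determines f i W = ∀ x y → AgreeOn W x y → f x i ≡ f y i

IsWindow : ∀ {A : Set} {n b j} → ((Fin j → Fin b) → (Fin n → A)) → Fin n → Subset j → Set
IsWindow f i W = Determines f i W × (∀ W' → Determines f i W' → W ⊆ W')

InCommComplex : ∀ {A : Set} {n b j} → ((Fin j → Fin b) → (Fin n → A)) → Subset n → Set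
InCommComplex {j = j} f S =
  ∃[ k ] (∀ i → i ∈ S → ∀ (W : Subset j) → IsWindow f i W → k ∈ W)

CommComplexIn : ∀ {A : Set} {n b j} → ((Fin j → Fin b) → (Fin n → A)) → Complex n → Set
CommComplexIn f K = ∀ S → InCommComplex f S → simplex K S ≡ true

Generates : ∀ {A : Set} {n} → Complex n → Language A n → Set
Generates {A} {n} K L =
  ∃[ b ] ∃[ j ] Σ ((Fin j → Fin b) → (Fin n → A)) λ f →
    (∀ (y : Fin n → A) → (L y → ∃[ x ] (∀ i → f x i ≡ y i))
                       × (∀ x → (∀ i → f x i ≡ y i) → L y))
    × CommComplexIn f K

MinimalGenerating : ∀ {A : Set} {n} → Complex n → Language A n → Set
MinimalGenerating K L = Generates K L × (∀ K' → K' ⊏ K → ¬ Generates K' L)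

-- Mon_n: non-decreasing or non-increasing binary strings (0 = false, 1 = true)
NonDecreasing : ∀ {n} → (Fin n → Bool) → Set
NonDecreasing {n} x = ∀ (i j : Fin n) → i F.≤ j → x i B.≤ x j

NonIncreasing : ∀ {n} → (Fin n → Bool) → Set
NonIncreasing {n} x = ∀ (i j : Fin n) → i F.≤ j → x j B.≤ x i

data Mon (n : ℕ) (x : Fin n → Bool) : Set where
  nondec : NonDecreasing x → Mon n x
  noninc : NonIncreasing x → Mon n x

MaximalSimplex : ∀ {n} → Complex n → Subset n → Set
MaximalSimplex K S = simplex K S ≡ true × (∀ T → simplex K T ≡ true → S ⊆ T → T ≡ S)

-- Interval of Z/nZ: [[a, a+k]] = { (a + t) mod n : 0 ≤ t ≤ k } with 0 ≤ k < n
-- (this is [[a,b]] with b' = a + k the representative in [a, a+n)).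
-- Since a < n and t < n, (a + t) mod n = i  iff  a + t = i  or  a + t = i + n.
ModEq : ℕ → ℕ → ℕ → Set
ModEq n i m = (m ≡ i) ⊎ (m ≡ i + n)

IsInterval : ∀ {n} → Subset n → Set
IsInterval {n} S = ∃[ a ] ∃[ k ] (k < n ×
  (∀ (i : Fin n) → (i ∈ S → ∃[ t ] (t ≤ k × ModEq n (toℕ i) (toℕ {n} a + t)))
                 × (∀ t → t ≤ k → ModEq n (toℕ i) (toℕ {n} a + t) → i ∈ S)))

-- Let gen generate Mon_n with K_gen ⊆ K, and let S be a maximal simplex of K.  S is nonempty,
-- for otherwise every window would be empty and gen constant.  If S were not an interval, two
-- positions t < t' outside S would separate a member q of S lying between them from a member o
-- lying outside [t, t'].  Let the positions strictly between t and t' read the coordinates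
-- shared by all windows of S from a fresh copy of the input.  The new map still generates Mon_n:
-- the windows of t and t' avoid the shared coordinates, and two monotone strings that agree at
-- t and t' but differ between them agree outside [t, t'].  Its communication complex lies in K
-- with S deleted, since q and o now read different copies, contradicting minimality.
-- A generator need not be extensional here, so the argument runs, under double negation, on an
-- extensional generator built from the given one.

module Submission where

open import Defs
open import Data.Nat as ℕ using (ℕ; zero; suc; _+_; _∸_; z≤n; s≤s; _≥_)
import Data.Nat.Properties as ℕ
open import Data.Fin as F using (Fin; toℕ; zero; suc; _↑ˡ_; _↑ʳ_; splitAt)
import Data.Fin.Properties as F
open import Data.Fin.Subset using (Subset; _∈_; _∉_; _⊆_; ⁅_⁆; ∁; Nonempty)
open import Data.Fin.Subset.Properties
  using (_∈?_; nonempty?; x∈⁅x⁆; x∈⁅y⁆⇒x≡y; x∉p⇒x∈∁p; x∈∁p⇒x∉p; x≢y⇒x∉⁅y⁆)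
open import Data.Vec using (tabulate; lookup)
open import Data.Vec.Properties using (lookup∘tabulate; tabulate-cong; []=⇒lookup; lookup⇒[]=; ≡-dec)
open import Data.Bool as B using (Bool; true; false; if_then_else_; _∧_; not)
import Data.Bool.Properties as B
open import Data.Product using (∃; ∃-syntax; _×_; _,_; proj₁; proj₂)
open import Data.Sum using (_⊎_; inj₁; inj₂; [_,_])
open import Data.Empty using (⊥-elim)
open import Function using (_∘_; id; _⇔_; mk⇔; Equivalence)
open import Level using (Level)
open import Relation.Binary.PropositionalEquality hiding ([_])
open import Relation.Binary.Definitions using (tri<; tri≈; tri>; DecidableEquality)
open import Relation.Nullary using (¬_; Dec; yes; no; does; contradiction)
open import Relation.Nullary.Decidable
  using (¬?; _×-dec_; _→-dec_; map′; dec-true; dec-false; decidable-stable; ¬¬-excluded-middle)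
open import Relation.Unary using (Pred; Decidable)

private
  variable
    ℓ : Level
    n b j : ℕ
    A : Set

fromDec : {P : Pred (Fin n) ℓ} → Decidable P → Subset n
fromDec P? = tabulate (does ∘ P?)

∈-fromDec⁺ : {P : Pred (Fin n) ℓ} (P? : Decidable P) {i : Fin n} → P i → i ∈ fromDec P?
∈-fromDec⁺ P? {i} p = lookup⇒[]= i _ (trans (lookup∘tabulate _ i) (dec-true (P? i) p))

∈-fromDec⁻ : {P : Pred (Fin n) ℓ} (P? : Decidable P) {i : Fin n} → i ∈ fromDec P? → P i
∈-fromDec⁻ P? {i} i∈ with P? i | trans (sym (lookup∘tabulate (does ∘ P?) i)) ([]=⇒lookup i∈)
... | yes p | _ = p

Mon-resp-≗ : {y z : Fin n → Bool} → y ≗ z → Mon n y → Mon n z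
Mon-resp-≗ y≗z (nondec y↑) = nondec λ i j i≤j → subst₂ B._≤_ (y≗z i) (y≗z j) (y↑ i j i≤j)
Mon-resp-≗ y≗z (noninc y↓) = noninc λ i j i≤j → subst₂ B._≤_ (y≗z j) (y≗z i) (y↓ i j i≤j)

mon? : Decidable (Mon n)
mon? y with F.all? (λ i → F.all? (λ j → (i F.≤? j) →-dec (y i B.≤? y j)))
           | F.all? (λ i → F.all? (λ j → (i F.≤? j) →-dec (y j B.≤? y i)))
... | yes y↑ | _ = yes (nondec y↑)
... | no _ | yes y↓ = yes (noninc y↓)
... | no ¬y↑ | no ¬y↓ = no λ { (nondec y↑) → ¬y↑ y↑ ; (noninc y↓) → ¬y↓ y↓ }

Mon-between : {y : Fin n → Bool} → Mon n y → {i k l : Fin n} → i F.≤ k → k F.≤ l →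
              y i ≡ y l → y k ≡ y i
Mon-between {y = y} (nondec y↑) {i} {k} {l} i≤k k≤l yi≡yl =
  B.≤-antisym (subst (y k B.≤_) (sym yi≡yl) (y↑ k l k≤l)) (y↑ i k i≤k)
Mon-between {y = y} (noninc y↓) {i} {k} {l} i≤k k≤l yi≡yl =
  B.≤-antisym (y↓ i k i≤k) (subst (B._≤ y k) (sym yi≡yl) (y↓ k l k≤l))

Mon-before-change : {y : Fin n → Bool} → Mon n y → {o t t' : Fin n} → o F.≤ t → t F.≤ t' →
                    y t ≢ y t' → y o ≡ y t
Mon-before-change {y = y} y-mon {o} {t} {t'} o≤t t≤t' yt≢yt' with y o B.≟ y t
... | yes yo≡yt = yo≡yt
... | no yo≢yt = contradiction (Mon-between y-mon o≤t t≤t' yo≡yt') (yo≢yt ∘ sym)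
  where
  yo≡yt' : y o ≡ y t'
  yo≡yt' = trans (B.¬-not yo≢yt) (sym (B.¬-not (yt≢yt' ∘ sym)))

Mon-after-change : {y : Fin n → Bool} → Mon n y → {t t' o : Fin n} → t F.≤ t' → t' F.≤ o →
                   y t ≢ y t' → y o ≡ y t'
Mon-after-change {y = y} y-mon {t} {t'} {o} t≤t' t'≤o yt≢yt' with y o B.≟ y t'
... | yes yo≡yt' = yo≡yt'
... | no yo≢yt' = contradiction (sym (Mon-between y-mon t≤t' t'≤o yt≡yo)) yt≢yt'
  where
  yt≡yo : y t ≡ y o
  yt≡yo = trans (B.¬-not yt≢yt') (sym (B.¬-not yo≢yt'))

-- Both strings change value inside [t, t'], and a monotone Boolean string changes value once.
Mon-agree-outside : {y z : Fin n → Bool} → Mon n y → Mon n z → {t q t' o : Fin n} →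
                    t F.< q → q F.< t' → y t ≡ z t → y t' ≡ z t' → y q ≢ z q →
                    o F.< t ⊎ t' F.< o → y o ≡ z o
Mon-agree-outside {y = y} {z} y-mon z-mon {t} {q} {t'} {o} t<q q<t' yt≡zt yt'≡zt' yq≢zq =
  [ before , after ]
  where
  open ≡-Reasoning
  t≤t' : t F.≤ t'
  t≤t' = ℕ.<⇒≤ (ℕ.<-trans t<q q<t')
  yt≢yt' : y t ≢ y t'
  yt≢yt' yt≡yt' = yq≢zq (begin
    y q ≡⟨ Mon-between y-mon (ℕ.<⇒≤ t<q) (ℕ.<⇒≤ q<t') yt≡yt' ⟩
    y t ≡⟨ yt≡zt ⟩
    z t ≡⟨ Mon-between z-mon (ℕ.<⇒≤ t<q) (ℕ.<⇒≤ q<t') (trans (sym yt≡zt) (trans yt≡yt' yt'≡zt')) ⟨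
    z q ∎)
  zt≢zt' : z t ≢ z t'
  zt≢zt' zt≡zt' = yt≢yt' (trans yt≡zt (trans zt≡zt' (sym yt'≡zt')))
  before : o F.< t → y o ≡ z o
  before o<t = begin
    y o ≡⟨ Mon-before-change y-mon (ℕ.<⇒≤ o<t) t≤t' yt≢yt' ⟩
    y t ≡⟨ yt≡zt ⟩
    z t ≡⟨ Mon-before-change z-mon (ℕ.<⇒≤ o<t) t≤t' zt≢zt' ⟨
    z o ∎
  after : t' F.< o → y o ≡ z o
  after t'<o = begin
    y o  ≡⟨ Mon-after-change y-mon t≤t' (ℕ.<⇒≤ t'<o) yt≢yt' ⟩
    y t' ≡⟨ yt'≡zt' ⟩
    z t' ≡⟨ Mon-after-change z-mon t≤t' (ℕ.<⇒≤ t'<o) zt≢zt' ⟨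
    z o  ∎

linear-interval : {S : Subset n} (lo hi : ℕ) → lo ℕ.< hi → hi ℕ.≤ n →
                  (∀ i → i ∈ S ⇔ (lo ℕ.≤ toℕ i × toℕ i ℕ.< hi)) → IsInterval S
linear-interval {n} lo hi lo<hi hi≤n S⇔ = a , k , k<n , λ i → member⇒offset i , offset⇒member i
  where
  open Equivalence
  a : Fin n
  a = F.fromℕ< (ℕ.<-≤-trans lo<hi hi≤n)
  a≡lo : toℕ a ≡ lo
  a≡lo = F.toℕ-fromℕ< _
  k : ℕ
  k = hi ∸ suc lo
  lo+k<hi : lo + k ℕ.< hi
  lo+k<hi = ℕ.≤-reflexive (ℕ.m+[n∸m]≡n lo<hi)
  lo+t<hi : ∀ {t} → t ℕ.≤ k → lo + t ℕ.< hi
  lo+t<hi t≤k = ℕ.≤-<-trans (ℕ.+-monoʳ-≤ lo t≤k) lo+k<hi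
  k<n : k ℕ.< n
  k<n = ℕ.<-≤-trans (ℕ.≤-<-trans (ℕ.m≤n+m k lo) lo+k<hi) hi≤n
  member⇒offset : ∀ i → i ∈ _ → ∃[ t ] (t ℕ.≤ k × ModEq n (toℕ i) (toℕ a + t))
  member⇒offset i i∈S with lo≤i , i<hi ← to (S⇔ i) i∈S =
    toℕ i ∸ lo , ℕ.∸-monoˡ-≤ (suc lo) i<hi ,
    inj₁ (trans (cong (_+ (toℕ i ∸ lo)) a≡lo) (ℕ.m+[n∸m]≡n lo≤i))
  offset⇒member : ∀ i t → t ℕ.≤ k → ModEq n (toℕ i) (toℕ a + t) → i ∈ _
  offset⇒member i t t≤k (inj₁ a+t≡i) =
    from (S⇔ i) (subst (lo ℕ.≤_) lo+t≡i (ℕ.m≤m+n lo t) , subst (ℕ._< hi) lo+t≡i (lo+t<hi t≤k))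
    where
    lo+t≡i : lo + t ≡ toℕ i
    lo+t≡i = trans (cong (_+ t) (sym a≡lo)) a+t≡i
  offset⇒member i t t≤k (inj₂ a+t≡i+n) = contradiction n≤lo+t (ℕ.<⇒≱ (ℕ.<-≤-trans (lo+t<hi t≤k) hi≤n))
    where
    n≤lo+t : n ℕ.≤ lo + t
    n≤lo+t = subst (n ℕ.≤_) (trans (sym a+t≡i+n) (cong (_+ t) a≡lo)) (ℕ.m≤n+m n (toℕ i))

wrapped-interval : {S : Subset n} (p r : ℕ) → p ℕ.< r → r ℕ.< n →
                   (∀ i → i ∈ S ⇔ (toℕ i ℕ.≤ p ⊎ r ℕ.≤ toℕ i)) → IsInterval S
wrapped-interval {n} p r p<r r<n S⇔ = a , k , k<n , λ i → member⇒offset i , offset⇒member i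
  where
  open Equivalence
  open ≡-Reasoning
  a : Fin n
  a = F.fromℕ< r<n
  a≡r : toℕ a ≡ r
  a≡r = F.toℕ-fromℕ< r<n
  k : ℕ
  k = (n ∸ r) + p
  r+[n∸r]≡n : r + (n ∸ r) ≡ n
  r+[n∸r]≡n = ℕ.m+[n∸m]≡n (ℕ.<⇒≤ r<n)
  k<n : k ℕ.< n
  k<n = subst (k ℕ.<_) (ℕ.m∸n+n≡m (ℕ.<⇒≤ r<n)) (ℕ.+-monoʳ-< (n ∸ r) p<r)
  r+[n∸r+m]≡m+n : ∀ m → r + ((n ∸ r) + m) ≡ m + n
  r+[n∸r+m]≡m+n m = begin
    r + ((n ∸ r) + m) ≡⟨ ℕ.+-assoc r (n ∸ r) m ⟨
    r + (n ∸ r) + m   ≡⟨ cong (_+ m) r+[n∸r]≡n ⟩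
    n + m             ≡⟨ ℕ.+-comm n m ⟩
    m + n             ∎
  member⇒offset : ∀ i → i ∈ _ → ∃[ t ] (t ℕ.≤ k × ModEq n (toℕ i) (toℕ a + t))
  member⇒offset i i∈S with to (S⇔ i) i∈S
  ... | inj₁ i≤p = (n ∸ r) + toℕ i , ℕ.+-monoʳ-≤ (n ∸ r) i≤p ,
                   inj₂ (trans (cong (_+ ((n ∸ r) + toℕ i)) a≡r) (r+[n∸r+m]≡m+n (toℕ i)))
  ... | inj₂ r≤i = toℕ i ∸ r ,
                   ℕ.≤-trans (ℕ.∸-monoˡ-≤ r (F.toℕ≤n i)) (ℕ.m≤m+n (n ∸ r) p) ,
                   inj₁ (trans (cong (_+ (toℕ i ∸ r)) a≡r) (ℕ.m+[n∸m]≡n r≤i))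
  offset⇒member : ∀ i t → t ℕ.≤ k → ModEq n (toℕ i) (toℕ a + t) → i ∈ _
  offset⇒member i t t≤k (inj₁ a+t≡i) =
    from (S⇔ i) (inj₂ (subst (r ℕ.≤_) (trans (cong (_+ t) (sym a≡r)) a+t≡i) (ℕ.m≤m+n r t)))
  offset⇒member i t t≤k (inj₂ a+t≡i+n) = from (S⇔ i) (inj₁ (ℕ.+-cancelʳ-≤ n (toℕ i) p i+n≤p+n))
    where
    i+n≤p+n : toℕ i + n ℕ.≤ p + n
    i+n≤p+n = subst₂ ℕ._≤_ (trans (cong (_+ t) (sym a≡r)) a+t≡i+n) (r+[n∸r+m]≡m+n p)
                (ℕ.+-monoʳ-≤ r t≤k)

outer-interval : {S : Subset n} → Nonempty S → (lo hi : ℕ) → lo ℕ.≤ hi → hi ℕ.< n →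
                 (∀ i → i ∈ S ⇔ (toℕ i ℕ.< lo ⊎ hi ℕ.< toℕ i)) → IsInterval S
outer-interval {n} (s , s∈S) zero hi _ hi<n S⇔ with suc hi ℕ.≟ n
... | yes 1+hi≡n = ⊥-elim ([ ℕ.n≮0 , (λ hi<s → ℕ.<⇒≱ (F.toℕ<n s) (subst (ℕ._≤ toℕ s) 1+hi≡n hi<s)) ]
                              (Equivalence.to (S⇔ s) s∈S))
... | no 1+hi≢n = linear-interval (suc hi) n (ℕ.≤∧≢⇒< hi<n 1+hi≢n) ℕ.≤-refl λ i →
  mk⇔ (λ i∈S → [ (λ ()) , (λ hi<i → hi<i , F.toℕ<n i) ] (Equivalence.to (S⇔ i) i∈S))
      (λ (hi<i , _) → Equivalence.from (S⇔ i) (inj₂ hi<i))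
outer-interval {n} _ (suc p) hi p<hi hi<n S⇔ with suc hi ℕ.≟ n
... | yes 1+hi≡n = linear-interval 0 (suc p) (s≤s z≤n) (ℕ.≤-trans p<hi (ℕ.<⇒≤ hi<n)) λ i →
  mk⇔ (λ i∈S → [ (z≤n ,_) , (λ hi<i → ⊥-elim (ℕ.<⇒≱ (F.toℕ<n i) (subst (ℕ._≤ toℕ i) 1+hi≡n hi<i))) ]
                   (Equivalence.to (S⇔ i) i∈S))
      (λ (_ , i<1+p) → Equivalence.from (S⇔ i) (inj₁ i<1+p))
... | no 1+hi≢n = wrapped-interval p (suc hi) (s≤s (ℕ.<⇒≤ p<hi)) (ℕ.≤∧≢⇒< hi<n 1+hi≢n) λ i →
  mk⇔ (λ i∈S → [ inj₁ ∘ ℕ.≤-pred , inj₂ ] (Equivalence.to (S⇔ i) i∈S))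
      (λ i∈ → Equivalence.from (S⇔ i) ([ inj₁ ∘ s≤s , inj₂ ] i∈))

least : {P : Pred (Fin n) ℓ} → Decidable P → ∃ P → ∃[ m ] (P m × ∀ {u} → P u → m F.≤ u)
least {n = suc n} {P = P} P? (w , Pw) with P? zero
... | yes P0 = zero , P0 , λ _ → z≤n
... | no ¬P0 with w
...   | zero = contradiction Pw ¬P0
...   | suc w with least (P? ∘ suc) (w , Pw)
...     | m , Pm , m-least =
  suc m , Pm , λ { {zero} P0 → contradiction P0 ¬P0 ; {suc u} Pu → s≤s (m-least Pu) }

greatest : {P : Pred (Fin n) ℓ} → Decidable P → ∃ P → ∃[ m ] (P m × ∀ {u} → P u → u F.≤ m)
greatest {n = suc n} {P = P} P? (w , Pw) with F.any? (P? ∘ suc)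
... | yes P-suc with greatest (P? ∘ suc) P-suc
...   | m , Pm , m-greatest = suc m , Pm , λ { {zero} _ → z≤n ; {suc u} Pu → s≤s (m-greatest Pu) }
greatest P? (zero , P0)  | no ¬P-suc =
  zero , P0 , λ { {zero} _ → z≤n ; {suc u} Pu → contradiction (u , Pu) ¬P-suc }
greatest P? (suc w , Pw) | no ¬P-suc = contradiction (w , Pw) ¬P-suc

record Split (S : Subset n) : Set where
  field
    t q t' o  : Fin n
    t∉S       : t ∉ S
    q∈S       : q ∈ S
    t'∉S      : t' ∉ S
    o∈S       : o ∈ S
    t<q       : t F.< q
    q<t'      : q F.< t'
    o-outside : o F.< t ⊎ t' F.< o

interval-around : {S : Subset n} → ¬ Split S → {t q t' : Fin n} → t ∉ S → q ∈ S → t' ∉ S →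
                  t F.< q → q F.< t' → IsInterval S
interval-around {S = S} unsplit {t} {q} {t'} t∉S q∈S t'∉S t<q q<t'
  with greatest (λ u → ¬? (u ∈? S) ×-dec (u F.<? q)) (t , t∉S , t<q)
     | least (λ u → ¬? (u ∈? S) ×-dec (q F.<? u)) (t' , t'∉S , q<t')
... | t₁ , (t₁∉S , t₁<q) , t₁-greatest | t₂ , (t₂∉S , q<t₂) , t₂-least =
  linear-interval (suc (toℕ t₁)) (toℕ t₂) (ℕ.≤-<-trans t₁<q q<t₂) (ℕ.<⇒≤ (F.toℕ<n t₂)) λ i →
    mk⇔ (inside i) (between⇒member i)
  where
  split-by : ∀ {o} → o ∈ S → o F.< t₁ ⊎ t₂ F.< o → Split S
  split-by o∈S o-out = record
    { t∉S = t₁∉S ; q∈S = q∈S ; t'∉S = t₂∉S ; o∈S = o∈S ; t<q = t₁<q ; q<t' = q<t₂ ; o-outside = o-out }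
  inside : ∀ i → i ∈ S → t₁ F.< i × i F.< t₂
  inside i i∈S with F.<-cmp i t₁ | F.<-cmp i t₂
  ... | tri< i<t₁ _ _ | _             = contradiction (split-by i∈S (inj₁ i<t₁)) unsplit
  ... | tri≈ _ refl _ | _             = contradiction i∈S t₁∉S
  ... | tri> _ _ t₁<i | tri< i<t₂ _ _ = t₁<i , i<t₂
  ... | tri> _ _ _    | tri≈ _ refl _ = contradiction i∈S t₂∉S
  ... | tri> _ _ _    | tri> _ _ t₂<i = contradiction (split-by i∈S (inj₂ t₂<i)) unsplit
  between⇒member : ∀ i → t₁ F.< i × i F.< t₂ → i ∈ S
  between⇒member i (t₁<i , i<t₂) with i ∈? S | F.<-cmp i q
  ... | yes i∈S | _             = i∈S
  ... | no i∉S  | tri< i<q _ _  = contradiction (t₁-greatest (i∉S , i<q)) (ℕ.<⇒≱ t₁<i)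
  ... | no i∉S  | tri≈ _ refl _ = contradiction q∈S i∉S
  ... | no i∉S  | tri> _ _ q<i  = contradiction (t₂-least (i∉S , q<i)) (ℕ.<⇒≱ i<t₂)

-- With c and d the least and greatest non-members, either some member lies between them, and S is
-- the block of members around it, or S wraps around as [0, c) ∪ (d, n).
unsplit⇒interval : {S : Subset n} → Nonempty S → ¬ Split S → IsInterval S
unsplit⇒interval {n} {S} S≠∅ unsplit with F.any? (λ i → ¬? (i ∈? S))
... | no no-gap = linear-interval 0 n (ℕ.≤-<-trans z≤n (F.toℕ<n (proj₁ S≠∅))) ℕ.≤-refl λ i →
  mk⇔ (λ _ → z≤n , F.toℕ<n i) (λ _ → decidable-stable (i ∈? S) (λ i∉S → no-gap (i , i∉S)))
... | yes gap with least (λ i → ¬? (i ∈? S)) gap | greatest (λ i → ¬? (i ∈? S)) gap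
...   | c , c∉S , c-least | d , d∉S , d-greatest
  with F.any? (λ q → (q ∈? S) ×-dec ((c F.<? q) ×-dec (q F.<? d)))
...   | yes (q , q∈S , c<q , q<d) = interval-around unsplit c∉S q∈S d∉S c<q q<d
...   | no ¬between = outer-interval S≠∅ (toℕ c) (toℕ d) (c-least d∉S) (F.toℕ<n d) λ i →
  mk⇔ (outside i) (λ i-out → decidable-stable (i ∈? S) (λ i∉S →
    [ (λ i<c → ℕ.<⇒≱ i<c (c-least i∉S)) , (λ d<i → ℕ.<⇒≱ d<i (d-greatest i∉S)) ] i-out))
  where
  outside : ∀ i → i ∈ S → i F.< c ⊎ d F.< i
  outside i i∈S with F.<-cmp i c | F.<-cmp i d
  ... | tri< i<c _ _ | _             = inj₁ i<c
  ... | tri≈ _ refl _ | _            = contradiction i∈S c∉S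
  ... | tri> _ _ _   | tri≈ _ refl _ = contradiction i∈S d∉S
  ... | tri> _ _ _   | tri> _ _ d<i  = inj₂ d<i
  ... | tri> _ _ c<i | tri< i<d _ _  = contradiction (_ , i∈S , c<i , i<d) ¬between

Extensional : ((Fin j → Fin b) → Fin n → A) → Set
Extensional f = ∀ {x y} → x ≗ y → ∀ i → f x i ≡ f y i

Determines-mono : {f : (Fin j → Fin b) → Fin n → A} {i : Fin n} {W W' : Subset j} →
                  W ⊆ W' → Determines f i W → Determines f i W'
Determines-mono W⊆W' W-det x y agree = W-det x y (λ k k∈W → agree k (W⊆W' k∈W))

all-functions? : {P : Pred (Fin j → Fin b) ℓ} → (∀ {x y} → x ≗ y → P x → P y) →
                 Decidable P → Dec (∀ x → P x)
all-functions? P-resp P? =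
  map′ (λ all x → P-resp (F.finToFun-funToFin x) (all (F.funToFin x))) (λ all → all ∘ F.finToFun)
       (F.all? (P? ∘ F.finToFun))

agreeOn? : (W : Subset j) (x y : Fin j → Fin b) → Dec (AgreeOn W x y)
agreeOn? W x y = F.all? λ k → (k ∈? W) →-dec (x k F.≟ y k)

hybrid : ℕ → (Fin j → Fin b) → (Fin j → Fin b) → Fin j → Fin b
hybrid r x y m = if does (toℕ m ℕ.<? r) then y m else x m

hybrid-below : ∀ {r} (x y : Fin j → Fin b) {m} → toℕ m ℕ.< r → hybrid r x y m ≡ y m
hybrid-below {r = r} x y {m} m<r rewrite dec-true (toℕ m ℕ.<? r) m<r = refl

hybrid-above : ∀ {r} (x y : Fin j → Fin b) {m} → r ℕ.≤ toℕ m → hybrid r x y m ≡ x m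
hybrid-above {r = r} x y {m} r≤m rewrite dec-false (toℕ m ℕ.<? r) (ℕ.≤⇒≯ r≤m) = refl

hybrid-suc : ∀ {r} (x y : Fin j → Fin b) {m} → toℕ m ≡ r →
             AgreeOn (∁ ⁅ m ⁆) (hybrid r x y) (hybrid (suc r) x y)
hybrid-suc {r = r} x y {m} refl k k∈∁m with ℕ.<-cmp (toℕ k) r
... | tri< k<r _ _ = trans (hybrid-below x y k<r) (sym (hybrid-below x y (ℕ.m<n⇒m<1+n k<r)))
... | tri≈ _ k≡r _ =
  contradiction (subst (_∈ ⁅ m ⁆) (sym (F.toℕ-injective k≡r)) (x∈⁅x⁆ m)) (x∈∁p⇒x∉p k∈∁m)
... | tri> _ _ r<k = trans (hybrid-above x y (ℕ.<⇒≤ r<k)) (sym (hybrid-above x y r<k))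

module Window {f : (Fin j → Fin b) → Fin n → A} (_≟ᴬ_ : DecidableEquality A)
              (f-ext : Extensional f) (i : Fin n) where

  determines? : (W : Subset j) → Dec (Determines f i W)
  determines? W =
    all-functions? resp-x λ x → all-functions? (resp-y x) λ y → agreeOn? W x y →-dec (f x i ≟ᴬ f y i)
    where
    resp-x : ∀ {x x'} → x ≗ x' → (∀ y → AgreeOn W x y → f x i ≡ f y i) →
             ∀ y → AgreeOn W x' y → f x' i ≡ f y i
    resp-x x≗x' det y agree = trans (sym (f-ext x≗x' i)) (det y λ k k∈W → trans (x≗x' k) (agree k k∈W))
    resp-y : ∀ x {y y'} → y ≗ y' → (AgreeOn W x y → f x i ≡ f y i) → AgreeOn W x y' → f x i ≡ f y' i
    resp-y x y≗y' det agree = trans (det λ k k∈W → trans (agree k k∈W) (sym (y≗y' k))) (f-ext y≗y' i)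

  Essential : Fin j → Set
  Essential m = ¬ Determines f i (∁ ⁅ m ⁆)

  essential? : Decidable Essential
  essential? m = ¬? (determines? (∁ ⁅ m ⁆))

  window : Subset j
  window = fromDec essential?

  inessential : ∀ {m} → m ∉ window → Determines f i (∁ ⁅ m ⁆)
  inessential {m} m∉W = decidable-stable (determines? (∁ ⁅ m ⁆)) (m∉W ∘ ∈-fromDec⁺ essential?)

  -- Walk from x to y one coordinate at a time; each step changes a coordinate that is
  -- either outside the window (inessential) or where x and y agree.
  window-determines : Determines f i window
  window-determines x y agree = begin
    f x i              ≡⟨ f-ext (λ m → sym (hybrid-above x y z≤n)) i ⟩
    f (hybrid 0 x y) i ≡⟨ walk j ℕ.≤-refl ⟩
    f (hybrid j x y) i ≡⟨ f-ext (λ m → hybrid-below x y (F.toℕ<n m)) i ⟩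
    f y i              ∎
    where
    open ≡-Reasoning
    step : ∀ r m → toℕ m ≡ r → f (hybrid r x y) i ≡ f (hybrid (suc r) x y) i
    step r m m≡r with m ∈? window
    ... | no m∉W = inessential m∉W _ _ (hybrid-suc x y m≡r)
    ... | yes m∈W = f-ext at-every-coordinate i
      where
      at-every-coordinate : hybrid r x y ≗ hybrid (suc r) x y
      at-every-coordinate k with k F.≟ m
      ... | no k≢m = hybrid-suc x y m≡r k (x∉p⇒x∈∁p (x≢y⇒x∉⁅y⁆ k≢m))
      ... | yes refl = begin
        hybrid r x y k       ≡⟨ hybrid-above x y (ℕ.≤-reflexive (sym m≡r)) ⟩
        x k                  ≡⟨ agree k m∈W ⟩
        y k                  ≡⟨ hybrid-below x y (ℕ.≤-reflexive (cong suc m≡r)) ⟨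
        hybrid (suc r) x y k ∎
    walk : ∀ r → r ℕ.≤ j → f (hybrid 0 x y) i ≡ f (hybrid r x y) i
    walk zero    _   = refl
    walk (suc r) r<j = trans (walk r (ℕ.<⇒≤ r<j)) (step r (F.fromℕ< r<j) (F.toℕ-fromℕ< r<j))

  window-least : ∀ D → Determines f i D → window ⊆ D
  window-least D D-det {m} m∈W with m ∈? D
  ... | yes m∈D = m∈D
  ... | no m∉D = contradiction (Determines-mono {f = f} D⊆∁m D-det) (∈-fromDec⁻ essential? m∈W)
    where
    D⊆∁m : D ⊆ ∁ ⁅ m ⁆
    D⊆∁m {k} k∈D = x∉p⇒x∈∁p λ k∈m → m∉D (subst (_∈ D) (x∈⁅y⁆⇒x≡y m k∈m) k∈D)

  window-isWindow : IsWindow f i window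
  window-isWindow = window-determines , window-least

image : ∀ {j'} → (Fin j → Fin j') → Subset j → Subset j'
image ρ D = fromDec λ k → F.any? λ m → (m ∈? D) ×-dec (ρ m F.≟ k)

∈-image⁺ : ∀ {j'} (ρ : Fin j → Fin j') {D m} → m ∈ D → ρ m ∈ image ρ D
∈-image⁺ ρ {D} {m} m∈D = ∈-fromDec⁺ (λ k → F.any? λ m → (m ∈? D) ×-dec (ρ m F.≟ k)) (m , m∈D , refl)

∈-image⁻ : ∀ {j'} (ρ : Fin j → Fin j') {D k} → k ∈ image ρ D → ∃[ m ] (m ∈ D × ρ m ≡ k)
∈-image⁻ ρ {D} = ∈-fromDec⁻ λ k → F.any? λ m → (m ∈? D) ×-dec (ρ m F.≟ k)

Determines-precompose : ∀ {j'} {f : (Fin j → Fin b) → Fin n → A} {i} (ρ : Fin j → Fin j') {D} →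
                        Determines f i D → Determines (λ x → f (x ∘ ρ)) i (image ρ D)
Determines-precompose ρ D-det x y agree = D-det (x ∘ ρ) (y ∘ ρ) λ m m∈D → agree (ρ m) (∈-image⁺ ρ m∈D)

copy : Bool → Fin j → Fin (j + j)
copy false m = m ↑ˡ _
copy true  m = _ ↑ʳ m

merge : Fin (j + j) → Fin j
merge {j} k = [ id , id ] (splitAt j k)

merge-copy : ∀ c (m : Fin j) → merge (copy c m) ≡ m
merge-copy {j} false m rewrite F.splitAt-↑ˡ j m j = refl
merge-copy {j} true  m rewrite F.splitAt-↑ʳ j j m = refl

copy-true≢copy-false : (m : Fin j) → copy true m ≢ copy false m
copy-true≢copy-false {j} m eq with
  trans (sym (F.splitAt-↑ʳ j j m)) (trans (cong (splitAt j) eq) (F.splitAt-↑ˡ j m j))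
... | ()

_≟ˢ_ : DecidableEquality (Subset n)
_≟ˢ_ = ≡-dec B._≟_

module Delete (K : Complex n) {S : Subset n} (S-max : MaximalSimplex K S) where

  kept : Subset n → Bool
  kept T = simplex K T ∧ not (does (T ≟ˢ S))

  kept⁻ : ∀ {T} → kept T ≡ true → simplex K T ≡ true × T ≢ S
  kept⁻ {T} T-kept with T ≟ˢ S
  ... | no T≢S = B.∧-conicalˡ _ _ T-kept , T≢S
  ... | yes _  = contradiction (trans (sym (B.∧-zeroʳ (simplex K T))) T-kept) λ ()

  kept⁺ : ∀ {T} → simplex K T ≡ true → T ≢ S → kept T ≡ true
  kept⁺ {T} T∈K T≢S rewrite T∈K | dec-false (T ≟ˢ S) T≢S = refl

  delete : Complex n
  delete = record
    { simplex    = kept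
    ; downClosed = λ {T} T'⊆T T-kept → let T∈K , T≢S = kept⁻ T-kept in
        kept⁺ (downClosed K T'⊆T T∈K) λ { refl → T≢S (proj₂ S-max T T∈K T'⊆T) }
    }

  delete-⊏ : delete ⊏ K
  delete-⊏ = (λ _ → proj₁ ∘ kept⁻) , S , proj₁ S-max , S-deleted
    where
    S-deleted : kept S ≡ false
    S-deleted rewrite dec-true (S ≟ˢ S) refl = B.∧-zeroʳ (simplex K S)

HasImage : ((Fin j → Fin b) → Fin n → A) → Language A n → Set
HasImage {n = n} f L = ∀ (y : Fin n → _) →
  (L y → ∃[ x ] (∀ i → f x i ≡ y i)) × (∀ x → (∀ i → f x i ≡ y i) → L y)

record ExtensionalGenerator (K : Complex n) (L : Language Bool n) : Set where
  field
    {alphabet arity} : ℕ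
    gen       : (Fin arity → Fin alphabet) → Fin n → Bool
    gen-ext   : Extensional gen
    gen-image : HasImage gen L
    gen-comm  : CommComplexIn gen K

  window : Fin n → Subset arity
  window = Window.window B._≟_ gen-ext

  window-isWindow : ∀ i → IsWindow gen i (window i)
  window-isWindow = Window.window-isWindow B._≟_ gen-ext

  window-least : ∀ i D → Determines gen i D → window i ⊆ D
  window-least = Window.window-least B._≟_ gen-ext

module MaximalSimplexOf {K : Complex n} {L : Language Bool n} (G : ExtensionalGenerator K L)
                        {S : Subset n} (S-max : MaximalSimplex K S) where
  open ExtensionalGenerator G

  Shared : Fin arity → Set
  Shared m = ∀ s → s ∈ S → m ∈ window s

  shared? : Decidable Shared
  shared? m = F.all? λ s → (s ∈? S) →-dec (m ∈? window s)

  star : Fin arity → Subset n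
  star m = fromDec λ i → m ∈? window i

  star-simplex : ∀ m → simplex K (star m) ≡ true
  star-simplex m = gen-comm (star m)
    (m , λ i i∈star W W-win → window-least i W (proj₁ W-win) (∈-fromDec⁻ (λ i → m ∈? window i) i∈star))

  shared-window : ∀ {i m} → i ∉ S → Shared m → m ∉ window i
  shared-window {i} {m} i∉S m-shared m∈Wi =
    i∉S (subst (i ∈_) star≡S (∈-fromDec⁺ (λ i → m ∈? window i) m∈Wi))
    where
    star≡S : star m ≡ S
    star≡S = proj₂ S-max (star m) (star-simplex m) λ {s} s∈S →
      ∈-fromDec⁺ (λ i → m ∈? window i) (m-shared s s∈S)

  -- If S were empty every coordinate would be shared, so position z would have an empty window.
  nonempty : (z : Fin n) {y y' : Fin n → Bool} → L y → L y' → y z ≢ y' z → Nonempty S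
  nonempty z {y} {y'} Ly Ly' yz≢y'z
    with x , gx≗y ← proj₁ (gen-image y) Ly | x' , gx'≗y' ← proj₁ (gen-image y') Ly' =
    decidable-stable (nonempty? S) λ S-empty → yz≢y'z (begin
      y z      ≡⟨ gx≗y z ⟨
      gen x z  ≡⟨ proj₁ (window-isWindow z) x x' (λ m m∈Wz → ⊥-elim (shared-window
                    (λ z∈S → S-empty (z , z∈S)) (λ s s∈S → contradiction (s , s∈S) S-empty) m∈Wz)) ⟩
      gen x' z ≡⟨ gx'≗y' z ⟩
      y' z     ∎)
    where open ≡-Reasoning

module Doubling {K : Complex n} (G : ExtensionalGenerator K (Mon n)) {S : Subset n}
                (S-max : MaximalSimplex K S) (split : Split S) where
  open ExtensionalGenerator G
  open MaximalSimplexOf G S-max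
  open Split split
  open Delete K S-max

  Between : Fin n → Set
  Between i = t F.< i × i F.< t'

  between? : Decidable Between
  between? i = (t F.<? i) ×-dec (i F.<? t')

  -- Positions strictly between t and t' read the shared coordinates of S from a second copy
  -- of the input, all other reads go to the first copy.
  inner : Fin arity → Fin (arity + arity)
  inner m = copy (does (shared? m)) m

  route : Fin n → Fin arity → Fin (arity + arity)
  route i m = copy (does (between? i) ∧ does (shared? m)) m

  route-outside : ∀ {i} → ¬ Between i → ∀ m → route i m ≡ copy false m
  route-outside {i} ¬Bi m rewrite dec-false (between? i) ¬Bi = refl

  route-inside : ∀ {i} → Between i → ∀ m → route i m ≡ inner m
  route-inside {i} Bi m rewrite dec-true (between? i) Bi = refl

  merge-route : ∀ i m → merge (route i m) ≡ m
  merge-route i m = merge-copy (does (between? i) ∧ does (shared? m)) m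

  doubled : (Fin (arity + arity) → Fin alphabet) → Fin n → Bool
  doubled x i = gen (x ∘ route i) i

  doubled-ext : Extensional doubled
  doubled-ext x≗y i = gen-ext (x≗y ∘ route i) i

  doubled-onto : ∀ y → Mon n y → ∃[ x ] (∀ i → doubled x i ≡ y i)
  doubled-onto y y-mon with x , gx≗y ← proj₁ (gen-image y) y-mon =
    x ∘ merge , λ i → trans (gen-ext (cong x ∘ merge-route i) i) (gx≗y i)

  module Readings (x : Fin (arity + arity) → Fin alphabet) where
    Y Z : Fin n → Bool
    Y = gen (x ∘ copy false)
    Z = gen (x ∘ inner)

    Y-mon : Mon n Y
    Y-mon = proj₂ (gen-image Y) _ λ _ → refl

    Z-mon : Mon n Z
    Z-mon = proj₂ (gen-image Z) _ λ _ → refl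

    doubled-outside : ∀ {i} → ¬ Between i → doubled x i ≡ Y i
    doubled-outside ¬Bi = gen-ext (cong x ∘ route-outside ¬Bi) _

    doubled-inside : ∀ {i} → Between i → doubled x i ≡ Z i
    doubled-inside Bi = gen-ext (cong x ∘ route-inside Bi) _

    -- The two copies differ only on shared coordinates, which lie outside the windows of non-members.
    agree-off-S : ∀ {i} → i ∉ S → Y i ≡ Z i
    agree-off-S {i} i∉S = proj₁ (window-isWindow i) _ _ λ m m∈Wi →
      cong (λ c → x (copy c m)) (sym (dec-false (shared? m) λ m-shared → shared-window i∉S m-shared m∈Wi))

    agree-beyond : ∀ {q} → Between q → Y q ≢ Z q → ∀ {i} → i F.< t ⊎ t' F.< i → Y i ≡ Z i
    agree-beyond (t<q , q<t') Yq≢Zq {i} =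
      Mon-agree-outside Y-mon Z-mon {o = i} t<q q<t' (agree-off-S t∉S) (agree-off-S t'∉S) Yq≢Zq

    agree-outside : ∀ {q} → Between q → Y q ≢ Z q → ∀ {i} → ¬ Between i → Y i ≡ Z i
    agree-outside Bq Yq≢Zq {i} ¬Bi with F.<-cmp i t | F.<-cmp i t'
    ... | tri< i<t _ _  | _             = agree-beyond Bq Yq≢Zq (inj₁ i<t)
    ... | tri≈ _ refl _ | _             = agree-off-S t∉S
    ... | tri> _ _ t<i  | tri< i<t' _ _ = contradiction (t<i , i<t') ¬Bi
    ... | tri> _ _ _    | tri≈ _ refl _ = agree-off-S t'∉S
    ... | tri> _ _ _    | tri> _ _ t'<i = agree-beyond Bq Yq≢Zq (inj₂ t'<i)

    doubled-mon : Mon n (doubled x)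
    doubled-mon with F.any? (λ q → between? q ×-dec ¬? (Y q B.≟ Z q))
    ... | no no-gap = Mon-resp-≗ (λ i → sym (doubled≗Y i)) Y-mon
      where
      doubled≗Y : ∀ i → doubled x i ≡ Y i
      doubled≗Y i with between? i
      ... | no ¬Bi = doubled-outside ¬Bi
      ... | yes Bi = trans (doubled-inside Bi)
                           (sym (decidable-stable (Y i B.≟ Z i) λ Yi≢Zi → no-gap (i , Bi , Yi≢Zi)))
    ... | yes (q , Bq , Yq≢Zq) = Mon-resp-≗ (λ i → sym (doubled≗Z i)) Z-mon
      where
      doubled≗Z : ∀ i → doubled x i ≡ Z i
      doubled≗Z i with between? i
      ... | no ¬Bi = trans (doubled-outside ¬Bi) (agree-outside Bq Yq≢Zq ¬Bi)
      ... | yes Bi = doubled-inside Bi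

  doubled-into : ∀ y x → (∀ i → doubled x i ≡ y i) → Mon n y
  doubled-into y x dx≗y = Mon-resp-≗ dx≗y (Readings.doubled-mon x)

  doubled-window : Fin n → Subset (arity + arity)
  doubled-window = Window.window B._≟_ doubled-ext

  doubled-window⊆image : ∀ i D → Determines gen i D → doubled-window i ⊆ image (route i) D
  doubled-window⊆image i D D-det =
    Window.window-least B._≟_ doubled-ext i (image (route i) D) (Determines-precompose {f = gen} (route i) D-det)

  -- A coordinate common to the windows of S' comes, through merge, from a coordinate common
  -- to the windows of gen on S'; if S' were S it would be shared, so q and o would read it
  -- from different copies.
  doubled-comm : CommComplexIn doubled delete
  doubled-comm S' (k , k-common) = kept⁺ S'∈K S'≢S
    where
    m₀ : Fin arity
    m₀ = merge k
    read-from : ∀ {i} → i ∈ S' → ∀ D → Determines gen i D → m₀ ∈ D × route i m₀ ≡ k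
    read-from {i} i∈S' D D-det
      with m , m∈D , route-m≡k ← ∈-image⁻ (route i) (doubled-window⊆image i D D-det
             (k-common i i∈S' (doubled-window i) (Window.window-isWindow B._≟_ doubled-ext i)))
      rewrite sym route-m≡k | merge-route i m = m∈D , refl
    S'∈K : simplex K S' ≡ true
    S'∈K = gen-comm S' (m₀ , λ i i∈S' W W-win → proj₁ (read-from i∈S' W (proj₁ W-win)))
    S'≢S : S' ≢ S
    S'≢S refl = copy-true≢copy-false m₀ (begin
      copy true m₀  ≡⟨ cong (λ c → copy c m₀) (dec-true (shared? m₀) m₀-shared) ⟨
      inner m₀      ≡⟨ route-inside (t<q , q<t') m₀ ⟨
      route q m₀    ≡⟨ proj₂ (read-from q∈S (window q) (proj₁ (window-isWindow q))) ⟩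
      k             ≡⟨ proj₂ (read-from o∈S (window o) (proj₁ (window-isWindow o))) ⟨
      route o m₀    ≡⟨ route-outside o-not-between m₀ ⟩
      copy false m₀ ∎)
      where
      open ≡-Reasoning
      m₀-shared : Shared m₀
      m₀-shared s s∈S = proj₁ (read-from s∈S (window s) (proj₁ (window-isWindow s)))
      o-not-between : ¬ Between o
      o-not-between (t<o , o<t') = [ F.<-asym t<o , F.<-asym o<t' ] o-outside

  doubled-generates : Generates delete (Mon n)
  doubled-generates =
    alphabet , arity + arity , doubled , (λ y → doubled-onto y , doubled-into y) , doubled-comm

HasWindow : ((Fin j → Fin b) → Fin n → A) → Fin n → Set
HasWindow f i = ∃ (IsWindow f i)

-- Since f need not be extensional, some positions may have no window at all. The new generator
-- reads the input through lookup ∘ tabulate (which turns pointwise equality into equality) and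
-- lets windowless positions read a private bit instead; whenever the resulting string falls
-- outside L it falls back to f itself.
module Extensionalise {K : Complex n} {L : Language Bool n} (L? : Decidable L)
                      (L-resp : ∀ {y z} → y ≗ z → L y → L z)
                      {b j} (f : (Fin (suc j) → Fin (suc b)) → Fin n → Bool)
                      (f-image : HasImage f L) (f-comm : CommComplexIn f K)
                      (windowed? : ∀ i → Dec (HasWindow f i)) where

  Input : Set
  Input = Fin (suc j + n) → Fin (suc (suc b))

  letter : Fin (suc (suc b)) → Fin (suc b)
  letter zero    = zero
  letter (suc v) = v

  bit : Fin (suc (suc b)) → Bool
  bit zero    = true
  bit (suc _) = false

  core : Input → Fin (suc j) → Fin (suc b)
  core x = lookup (tabulate (letter ∘ x ∘ (_↑ˡ n)))

  base : Input → Fin n → Bool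
  base x = f (core x)

  candidate : Input → Fin n → Bool
  candidate x i with windowed? i
  ... | yes _ = base x i
  ... | no _  = bit (x (suc j ↑ʳ i))

  choose : ∀ x → Dec (L (candidate x)) → Fin n → Bool
  choose x (yes _) = candidate x
  choose x (no _)  = base x

  g : Input → Fin n → Bool
  g x = choose x (L? (candidate x))

  base-ext : ∀ {x y} → x ≗ y → base x ≡ base y
  base-ext x≗y = cong (f ∘ lookup) (tabulate-cong (cong letter ∘ x≗y ∘ (_↑ˡ n)))

  candidate-ext : ∀ {x y} → x ≗ y → candidate x ≗ candidate y
  candidate-ext {x} {y} x≗y i with windowed? i
  ... | yes _ = cong (λ h → h i) (base-ext x≗y)
  ... | no _  = cong bit (x≗y (suc j ↑ʳ i))

  g-ext : Extensional g
  g-ext {x} {y} x≗y i = by-choices (L? (candidate x)) (L? (candidate y))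
    where
    by-choices : ∀ dx dy → choose x dx i ≡ choose y dy i
    by-choices (yes _)   (yes _)   = candidate-ext x≗y i
    by-choices (no _)    (no _)    = cong (λ h → h i) (base-ext x≗y)
    by-choices (yes Lx)  (no ¬Ly)  = contradiction (L-resp (candidate-ext x≗y) Lx) ¬Ly
    by-choices (no ¬Lx)  (yes Ly)  = contradiction (L-resp (sym ∘ candidate-ext x≗y) Ly) ¬Lx

  g-windowed : ∀ {i} → HasWindow f i → ∀ x → g x i ≡ base x i
  g-windowed {i} has-window x with L? (candidate x)
  ... | no _ = refl
  ... | yes _ with windowed? i
  ...   | yes _ = refl
  ...   | no no-window = contradiction has-window no-window

  g-into : ∀ y x → (∀ i → g x i ≡ y i) → L y
  g-into y x gx≗y with L? (candidate x)
  ... | yes L-cand = L-resp gx≗y L-cand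
  ... | no _       = L-resp gx≗y (proj₂ (f-image (base x)) (core x) λ _ → refl)

  g-onto : ∀ y → L y → ∃[ x ] (∀ i → g x i ≡ y i)
  g-onto y Ly with x , fx≗y ← proj₁ (f-image y) Ly = x' , g≗y
    where
    encode : Bool → Fin (suc (suc b))
    encode true  = zero
    encode false = suc zero
    x' : Input
    x' = [ suc ∘ x , encode ∘ y ] ∘ splitAt (suc j)
    core≗x : core x' ≗ x
    core≗x m rewrite lookup∘tabulate (letter ∘ x' ∘ (_↑ˡ n)) m | F.splitAt-↑ˡ (suc j) m n = refl
    candidate≗y : candidate x' ≗ y
    candidate≗y i with windowed? i
    ... | yes (W , W-win) = trans (proj₁ W-win (core x') x λ m _ → core≗x m) (fx≗y i)
    ... | no _ rewrite F.splitAt-↑ʳ (suc j) n i with y i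
    ...   | true  = refl
    ...   | false = refl
    g≗y : ∀ i → g x' i ≡ y i
    g≗y with L? (candidate x')
    ... | yes _  = candidate≗y
    ... | no ¬L = contradiction (L-resp (sym ∘ candidate≗y) Ly) ¬L

  image-determines : ∀ {i W} → IsWindow f i W → Determines g i (image (_↑ˡ n) W)
  image-determines {i} {W} W-win x y agree = begin
    g x i    ≡⟨ g-windowed (W , W-win) x ⟩
    base x i ≡⟨ proj₁ W-win (core x) (core y) core-agree ⟩
    base y i ≡⟨ g-windowed (W , W-win) y ⟨
    g y i    ∎
    where
    open ≡-Reasoning
    core-agree : ∀ m → m ∈ W → core x m ≡ core y m
    core-agree m m∈W = begin
      core x m              ≡⟨ lookup∘tabulate (letter ∘ x ∘ (_↑ˡ n)) m ⟩
      letter (x (m ↑ˡ n))   ≡⟨ cong letter (agree (m ↑ˡ n) (∈-image⁺ (_↑ˡ n) m∈W)) ⟩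
      letter (y (m ↑ˡ n))   ≡⟨ lookup∘tabulate (letter ∘ y ∘ (_↑ˡ n)) m ⟨
      core y m              ∎

  g-window : Fin n → Subset (suc j + n)
  g-window = Window.window B._≟_ g-ext

  g-window⊆image : ∀ {i W} → IsWindow f i W → g-window i ⊆ image (_↑ˡ n) W
  g-window⊆image {i} {W} W-win = Window.window-least B._≟_ g-ext i (image (_↑ˡ n) W) (image-determines W-win)

  -- Only windowed positions constrain f-comm, and their g-windows lie in the first block;
  -- the default zero for the second block is never inspected.
  g-comm : CommComplexIn g K
  g-comm S' (k , k-common) = f-comm S' (first k , first-common)
    where
    first : Fin (suc j + n) → Fin (suc j)
    first = [ id , (λ _ → zero) ] ∘ splitAt (suc j)
    first-common : ∀ i → i ∈ S' → ∀ W → IsWindow f i W → first k ∈ W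
    first-common i i∈S' W W-win
      with m , m∈W , m↑≡k ← ∈-image⁻ (_↑ˡ n)
             (g-window⊆image W-win (k-common i i∈S' (g-window i) (Window.window-isWindow B._≟_ g-ext i)))
      rewrite sym m↑≡k | F.splitAt-↑ˡ (suc j) m n = m∈W

  generator : ExtensionalGenerator K L
  generator = record
    { gen = g ; gen-ext = g-ext ; gen-image = λ y → g-onto y , g-into y ; gen-comm = g-comm }

void : Complex n
void = record { simplex = λ _ → false ; downClosed = λ _ () }

void-⊏ : {K : Complex n} {S : Subset n} → simplex K S ≡ true → void ⊏ K
void-⊏ {S = S} S∈K = (λ _ ()) , S , S∈K , refl

nullary-generates : (K : Complex n) {L : Language A n} (f : (Fin 0 → Fin b) → Fin n → A) →
                    HasImage f L → Generates K L
nullary-generates K f f-image = _ , 0 , f , f-image , λ _ ()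

¬¬-Π : {P : Fin n → Set ℓ} → (∀ i → ¬ ¬ P i) → ¬ ¬ (∀ i → P i)
¬¬-Π {n = zero}  _   ¬all = ¬all λ ()
¬¬-Π {n = suc n} ¬¬P ¬all =
  ¬¬P zero λ P0 → ¬¬-Π (¬¬P ∘ suc) λ P-suc → ¬all λ { zero → P0 ; (suc i) → P-suc i }

¬¬-extensional-generator : {K : Complex n} {L : Language Bool n} → Decidable L →
                           (∀ {y z} → y ≗ z → L y → L z) → ∃ L → ∃[ S ] simplex K S ≡ true →
                           MinimalGenerating K L → ¬ ¬ ExtensionalGenerator K L
¬¬-extensional-generator {K = K} _ _ _ (S , S∈K) ((_ , zero , f , f-image , _) , K-min) _ =
  K-min void (void-⊏ {K = K} {S = S} S∈K) (nullary-generates void f f-image)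
¬¬-extensional-generator _ _ (y , Ly) _ ((zero , suc _ , _ , f-image , _) , _) _
  with x , _ ← proj₁ (f-image y) Ly with x zero
... | ()
¬¬-extensional-generator L? L-resp _ _ ((suc _ , suc _ , f , f-image , f-comm) , _) ¬G =
  ¬¬-Π (λ _ → ¬¬-excluded-middle) λ windowed? →
    ¬G (Extensionalise.generator L? L-resp f f-image f-comm windowed?)

theorem4p3 : (n : ℕ) → n ≥ 1 → (K : Complex n) → MinimalGenerating K (Mon n) → (S : Subset n) → MaximalSimplex K S → IsInterval S
theorem4p3 (suc n) _ K K-min S S-max = unsplit⇒interval S-nonempty unsplit
  where
  open Delete K S-max
  constant-mon : ∀ c → Mon (suc n) (λ _ → c)
  constant-mon c = nondec λ _ _ _ → B.≤-refl
  extensional : ¬ ¬ ExtensionalGenerator K (Mon (suc n))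
  extensional = ¬¬-extensional-generator mon? Mon-resp-≗ (_ , constant-mon false) (S , proj₁ S-max) K-min
  S-nonempty : Nonempty S
  S-nonempty = decidable-stable (nonempty? S) λ S-empty → extensional λ G →
    S-empty (MaximalSimplexOf.nonempty G S-max zero (constant-mon false) (constant-mon true) λ ())
  unsplit : ¬ Split S
  unsplit split = extensional λ G → proj₂ K-min delete delete-⊏ (Doubling.doubled-generates G S-max split)
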